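{- Let $t$ be an edge labeling of $K_n$ and $p$ a positive integer. If an edge set $F$ with $|F|\ge 2p$ is such that $S(t,F)$ is a 1-AP, then for every $p$-swap $\theta$ of $t$, $|s(\theta t,F)-s(t,F)|\le p^2$.
   Context: $K_n$ is the complete graph on $n$ vertices with edge set $E$, $\epsilon=\binom n2$, $[a]=\{1,\dots,a\}$; a 1-AP is a set of consecutive integers. An edge labeling is a bijection $t:E\to[\epsilon]$; for $F\subseteq E$, $S(t,F)=\{t(e):e\in F\}$ and $s(t,F)=\sum_{e\in F}t(e)$. A $p$-swap of $t$ is a map $\theta$ sending $t$ to another edge labeling $\theta t$ with $|t(e)-\theta t(e)|\le p$ for all $e\in E$. -}

module Defs where

open import Data.Nat using (ℕ; suc; _+_; _≤_; _<_)
open import Data.Nat.Combinatorics using (_C_)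
open import Data.Fin as Fin using (Fin; toℕ)
open import Data.Product using (Σ; ∃; _×_)
open import Data.List using (List; map)
open import Data.Nat.ListAction using (sum)
open import Data.List.Membership.Propositional using (_∈_)
open import Function.Bundles using (_⤖_; _⇔_; Bijection)

-- Edges of the complete graph K_n: pairs {i,j} represented as (i , j , i<j).
Edge : ℕ → Set
Edge n = Σ (Fin n) λ i → Σ (Fin n) λ j → i Fin.< j

ε : ℕ → ℕ
ε n = n C 2

-- An edge labeling: a bijection E → [ε]; [ε] = {1..ε} is modelled as Fin ε
-- with label value suc (toℕ k).
Labeling : ℕ → Set
Labeling n = Edge n ⤖ Fin (ε n)

label : ∀ {n} → Labeling n → Edge n → ℕ
label t e = suc (toℕ (Bijection.to t e))

-- S(t,F) as a list of values (F is a duplicate-free list of edges)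
S : ∀ {n} → Labeling n → List (Edge n) → List ℕ
S t F = map (label t) F

s : ∀ {n} → Labeling n → List (Edge n) → ℕ
s t F = sum (S t F)

Is1AP : List ℕ → Set
Is1AP xs = ∃ λ a → ∃ λ k → ∀ m → (m ∈ xs) ⇔ (a ≤ m × m < a + k)

IsPSwap : ∀ {n} → ℕ → Labeling n → Labeling n → Set
IsPSwap p t t' = ∀ e → Data.Nat.∣ label t e - label t' e ∣ ≤ p

{-# OPTIONS --safe #-}
-- Relabelling by θ ∘ t⁻¹, extended by the identity off the label set, gives a permutation σ
-- of ℕ moving no point by more than p; as S(t,F) is an interval [a, a + k), the claim becomes
-- |Σ_{x ∈ [a, a+k)} σ x − Σ_{x ∈ [a, a+k)} x| ≤ p².  On an initial segment [0, b) the values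
-- σ[0, b) are b distinct numbers, so they sum to at least tri b = 0 + 1 + ⋯ + (b − 1); they
-- contain all of [0, b − p), and the other ℓ ≤ p of them are distinct and below b + p, so
-- they sum to at most tri b + p².  Subtracting these estimates at a and at a + k gives the
-- claim.
module Submission where

open import Defs
open import Data.Nat using (ℕ; zero; suc; z<s; _+_; _*_; _∸_; _≤_; _<_; _>_; z≤n; s≤s; ∣_-_∣)
open import Data.Nat.Properties
open import Data.Nat.ListAction using (sum)
open import Data.Nat.ListAction.Properties using (sum-++; sum-↭)
open import Data.Nat.Tactic.RingSolver using (solve-∀)
open import Data.Fin as Fin using (Fin; toℕ; fromℕ<)
open import Data.Fin.Properties using (toℕ<n; fromℕ<-toℕ; toℕ-fromℕ<; toℕ-injective)
open import Data.Fin.Permutation using (Permutation′; _⟨$⟩ʳ_; _⟨$⟩ˡ_; lift₀)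
open import Data.List using (List; []; _∷_; _++_; map; length; filter)
open import Data.List.Properties using (length-++; length-map; map-++; map-cong; map-∘)
open import Data.List.Membership.Propositional using (_∈_)
open import Data.List.Membership.Propositional.Properties using (∈-filter⁺; ∈-filter⁻; ∈-map⁺)
open import Data.List.Membership.Propositional.Properties.WithK using (unique∧set⇒bag)
open import Data.List.Relation.Binary.BagAndSetEquality using (∼bag⇒↭)
open import Data.List.Relation.Binary.Permutation.Propositional using (_↭_; ↭-refl; ↭-prep; ↭-trans; ↭-sym; ↭⇒↭ₛ)
open import Data.List.Relation.Binary.Permutation.Propositional.Properties using (shift; ↭-length; All-resp-↭)
import Data.List.Relation.Binary.Permutation.Propositional.Properties as ↭
import Data.List.Relation.Binary.Permutation.Setoid.Properties as ↭ₛ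
open import Data.List.Relation.Unary.All as All using (All; []; _∷_)
import Data.List.Relation.Unary.All.Properties as All
open import Data.List.Relation.Unary.AllPairs as AllPairs using (AllPairs; []; _∷_)
open import Data.List.Relation.Unary.Any using (here; there)
open import Data.List.Relation.Unary.Linked.Properties using (Linked⇒AllPairs)
open import Data.List.Relation.Unary.Unique.Propositional using (Unique)
import Data.List.Relation.Unary.Unique.Propositional.Properties as Unique
import Data.List.Sort as Sort
open import Data.Product using (_×_; _,_; proj₁; proj₂; uncurry)
open import Data.Bool using (true; false)
open import Data.Empty using (⊥-elim)
open import Data.Sum using (inj₁; inj₂)
open import Function using (_∘_; flip)
open import Function.Bundles using (_⇔_; mk⇔; Equivalence; _↔_; Inverse; Injection; mk↔ₛ′; Bijection)
open import Function.Definitions using (StrictlyInverseˡ)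
open import Function.Construct.Composition using (_↔-∘_)
open import Function.Construct.Symmetry using (↔-sym)
open import Function.Properties.Bijection using (⤖⇒↔)
open import Function.Properties.Inverse using (↔⇒↣)
import Function.Properties.Equivalence as ⇔
open import Relation.Binary.PropositionalEquality using (_≡_; refl; sym; trans; cong; cong₂; subst; subst₂; setoid; ≢-sym; module ≡-Reasoning)
open import Relation.Binary.Properties.DecTotalOrder ≤-decTotalOrder using (≥-decTotalOrder)
open import Relation.Nullary using (does; yes; no; contradiction)
open import Relation.Unary using (Pred; Decidable)
open import Relation.Unary.Properties using (∁?)

tri : ℕ → ℕ
tri zero    = 0
tri (suc n) = tri n + n

tri+tri+n≡n*n : ∀ n → tri n + tri n + n ≡ n * n
tri+tri+n≡n*n zero    = refl
tri+tri+n≡n*n (suc n) = begin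
  tri n + n + (tri n + n) + suc n ≡⟨ regroup (tri n) n ⟩
  (tri n + tri n + n) + n + suc n ≡⟨ cong (λ m → m + n + suc n) (tri+tri+n≡n*n n) ⟩
  n * n + n + suc n               ≡⟨ square-suc n ⟩
  suc n * suc n                   ∎
  where
  open ≡-Reasoning
  regroup : ∀ t n → t + n + (t + n) + suc n ≡ t + t + n + n + suc n
  regroup = solve-∀
  square-suc : ∀ n → n * n + n + suc n ≡ suc n * suc n
  square-suc = solve-∀

range : ℕ → ℕ → List ℕ
range a zero    = []
range a (suc k) = a ∷ range (suc a) k

∈-range : ∀ {m} a k → m ∈ range a k ⇔ (a ≤ m × m < a + k)
∈-range {m} a k = mk⇔ (to a k) (uncurry (from a k))
  where
  to : ∀ a k → m ∈ range a k → a ≤ m × m < a + k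
  to a (suc k) (here refl) = ≤-refl , m<m+n a z<s
  to a (suc k) (there m∈) with to (suc a) k m∈
  ... | a<m , m<a+k = <⇒≤ a<m , ≤-trans m<a+k (≤-reflexive (sym (+-suc a k)))
  from : ∀ a k → a ≤ m → m < a + k → m ∈ range a k
  from a zero    a≤m m<a+0 = ⊥-elim (<⇒≱ (≤-trans m<a+0 (≤-reflexive (+-identityʳ a))) a≤m)
  from a (suc k) a≤m m<a+k with m≤n⇒m<n∨m≡n a≤m
  ... | inj₂ refl = here refl
  ... | inj₁ a<m  = there (from (suc a) k a<m (≤-trans m<a+k (≤-reflexive (+-suc a k))))

length-range : ∀ a k → length (range a k) ≡ k
length-range a zero    = refl
length-range a (suc k) = cong suc (length-range (suc a) k)

range-unique : ∀ a k → Unique (range a k)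
range-unique a zero    = []
range-unique a (suc k) =
  All.tabulate (λ y∈ → <⇒≢ (proj₁ (Equivalence.to (∈-range (suc a) k) y∈))) ∷ range-unique (suc a) k

range-++ : ∀ a k l → range a (k + l) ≡ range a k ++ range (a + k) l
range-++ a zero    l = cong (λ b → range b l) (sym (+-identityʳ a))
range-++ a (suc k) l = cong (a ∷_) (begin
  range (suc a) (k + l)                   ≡⟨ range-++ (suc a) k l ⟩
  range (suc a) k ++ range (suc a + k) l  ≡⟨ cong (λ b → range (suc a) k ++ range b l) (sym (+-suc a k)) ⟩
  range (suc a) k ++ range (a + suc k) l  ∎)
  where open ≡-Reasoning

sum-range : ∀ a k → sum (range a k) ≡ a * k + tri k
sum-range a zero    = sym (cong (_+ 0) (*-zeroʳ a))
sum-range a (suc k) = begin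
  a + sum (range (suc a) k)    ≡⟨ cong (a +_) (sum-range (suc a) k) ⟩
  a + (suc a * k + tri k)      ≡⟨ regroup a k (tri k) ⟩
  a * suc k + (tri k + k)      ∎
  where
  open ≡-Reasoning
  regroup : ∀ a k t → a + (suc a * k + t) ≡ a * suc k + (t + k)
  regroup = solve-∀

tri-+ : ∀ m n → tri (m + n) ≡ tri m + sum (range m n)
tri-+ m n = begin
  tri (m + n)                           ≡⟨ sum-range 0 (m + n) ⟨
  sum (range 0 (m + n))                 ≡⟨ cong sum (range-++ 0 m n) ⟩
  sum (range 0 m ++ range m n)          ≡⟨ sum-++ (range 0 m) (range m n) ⟩
  sum (range 0 m) + sum (range m n)     ≡⟨ cong (_+ sum (range m n)) (sum-range 0 m) ⟩
  tri m + sum (range m n)               ∎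
  where open ≡-Reasoning

↭-range : ∀ {xs} a k → Unique xs → (∀ {m} → m ∈ xs ⇔ (a ≤ m × m < a + k)) → xs ↭ range a k
↭-range a k xs! xs≈range =
  ∼bag⇒↭ (unique∧set⇒bag xs! (range-unique a k) (⇔.trans xs≈range (⇔.sym (∈-range a k))))

↭-filter-++-reject : ∀ {a p} {A : Set a} {P : Pred A p} (P? : Decidable P) xs →
                     xs ↭ filter P? xs ++ filter (∁? P?) xs
↭-filter-++-reject P? []       = ↭-refl
↭-filter-++-reject P? (x ∷ xs) with does (P? x)
... | true  = ↭-prep x (↭-filter-++-reject P? xs)
... | false = ↭-trans (↭-prep x (↭-filter-++-reject P? xs)) (↭-sym (shift x (filter P? xs) _))

sum-ascending-≥ : ∀ {d xs} → AllPairs _<_ xs → All (d ≤_) xs → d * length xs + tri (length xs) ≤ sum xs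
sum-ascending-≥ {d} {[]}     []           []      = ≤-reflexive (cong (_+ 0) (*-zeroʳ d))
sum-ascending-≥ {d} {x ∷ xs} (x<xs ∷ xs↑) (d≤x ∷ _) = begin
  d * suc ℓ + (tri ℓ + ℓ)   ≡⟨ regroup d ℓ (tri ℓ) ⟩
  d + (suc d * ℓ + tri ℓ)   ≤⟨ +-mono-≤ d≤x (sum-ascending-≥ xs↑ (All.map (≤-<-trans d≤x) x<xs)) ⟩
  x + sum xs                ∎
  where
  open ≤-Reasoning
  ℓ = length xs
  regroup : ∀ d l t → d * suc l + (t + l) ≡ d + (suc d * l + t)
  regroup = solve-∀

sum-descending-≤ : ∀ {M xs} → AllPairs _>_ xs → All (_< M) xs → sum xs + tri (suc (length xs)) ≤ length xs * M
sum-descending-≤ {M} {[]}     []           []      = z≤n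
sum-descending-≤ {M} {x ∷ xs} (x>xs ∷ xs↓) (x<M ∷ _) = begin
  x + sum xs + (tri (suc ℓ) + suc ℓ)   ≡⟨ regroup x (sum xs) (tri (suc ℓ)) ℓ ⟩
  x + (sum xs + tri (suc ℓ)) + suc ℓ   ≤⟨ +-monoˡ-≤ (suc ℓ) (+-monoʳ-≤ x (sum-descending-≤ xs↓ x>xs)) ⟩
  x + ℓ * x + suc ℓ                    ≡⟨ factor x ℓ ⟩
  suc ℓ * suc x                        ≤⟨ *-monoʳ-≤ (suc ℓ) x<M ⟩
  suc ℓ * M                            ∎
  where
  open ≤-Reasoning
  ℓ = length xs
  regroup : ∀ x s t l → x + s + (t + suc l) ≡ x + (s + t) + suc l
  regroup = solve-∀
  factor : ∀ x l → x + l * x + suc l ≡ suc l * suc x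
  factor = solve-∀

module _ {xs : List ℕ} (xs! : Unique xs) where
  private
    ↭-unique : ∀ {ys} → ys ↭ xs → Unique ys
    ↭-unique ys↭xs = ↭ₛ.Unique-resp-↭ (setoid ℕ) (↭⇒↭ₛ (↭-sym ys↭xs)) xs!

  tri-length≤sum : tri (length xs) ≤ sum xs
  tri-length≤sum = subst₂ (λ ℓ s → tri ℓ ≤ s) (↭-length ys↭xs) (sum-↭ ys↭xs)
    (sum-ascending-≥ ys↑ (All.tabulate (λ _ → z≤n)))
    where
    open Sort ≤-decTotalOrder using (sort; sort-↭; sort-↗)
    ys↭xs = sort-↭ xs
    ys↑ : AllPairs _<_ (sort xs)
    ys↑ = AllPairs.zipWith (uncurry ≤∧≢⇒<) (Linked⇒AllPairs ≤-trans (sort-↗ xs) , ↭-unique ys↭xs)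

  sum+tri≤length*bound : ∀ {M} → All (_< M) xs → sum xs + tri (suc (length xs)) ≤ length xs * M
  sum+tri≤length*bound {M} xs<M = subst₂ (λ ℓ s → s + tri (suc ℓ) ≤ ℓ * M) (↭-length ys↭xs) (sum-↭ ys↭xs)
    (sum-descending-≤ ys↓ (All-resp-↭ (↭-sym ys↭xs) xs<M))
    where
    open Sort ≥-decTotalOrder using (sort; sort-↭; sort-↗)
    ys↭xs = sort-↭ xs
    ys↓ : AllPairs _>_ (sort xs)
    ys↓ = AllPairs.zipWith (λ (y≤x , x≢y) → ≤∧≢⇒< y≤x (≢-sym x≢y))
            (Linked⇒AllPairs (flip ≤-trans) (sort-↗ xs) , ↭-unique ys↭xs)

-- ℓ distinct numbers below c + ℓ + p exceed the block [c, c + ℓ) by at most ℓ * p ≤ p * p.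
square-slack : ∀ c {ℓ p} s → ℓ ≤ p → s + (tri ℓ + ℓ) ≤ ℓ * (c + ℓ + p) → s ≤ c * ℓ + tri ℓ + p * p
square-slack c {ℓ} {p} s ℓ≤p bound = +-cancelʳ-≤ (tri ℓ + ℓ) s _ (begin
  s + (tri ℓ + ℓ)                               ≤⟨ bound ⟩
  ℓ * (c + ℓ + p)                               ≡⟨ expand c ℓ p ⟩
  c * ℓ + ℓ * ℓ + ℓ * p                         ≤⟨ +-monoʳ-≤ (c * ℓ + ℓ * ℓ) (*-monoˡ-≤ p ℓ≤p) ⟩
  c * ℓ + ℓ * ℓ + p * p                         ≡⟨ cong (λ q → c * ℓ + q + p * p) (tri+tri+n≡n*n ℓ) ⟨
  c * ℓ + (tri ℓ + tri ℓ + ℓ) + p * p           ≡⟨ regroup (c * ℓ) (tri ℓ) ℓ (p * p) ⟩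
  c * ℓ + tri ℓ + p * p + (tri ℓ + ℓ)           ∎)
  where
  open ≤-Reasoning
  expand : ∀ c ℓ p → ℓ * (c + ℓ + p) ≡ c * ℓ + ℓ * ℓ + ℓ * p
  expand = solve-∀
  regroup : ∀ a t ℓ q → a + (t + t + ℓ) + q ≡ a + t + q + (t + ℓ)
  regroup = solve-∀

sum≤tri+square : ∀ {b p V} → Unique V → length V ≡ b → All (_< b + p) V →
                 (∀ {y} → y < b ∸ p → y ∈ V) → sum V ≤ tri b + p * p
sum≤tri+square {b} {p} {V} V! |V|≡b V<b+p V⊇ = begin
  sum V                               ≡⟨ sum-↭ V↭small++large ⟩
  sum (small ++ large)                ≡⟨ sum-++ small large ⟩
  sum small + sum large               ≡⟨ cong (_+ sum large) sum-small ⟩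
  tri c + sum large                   ≤⟨ +-monoʳ-≤ (tri c) (square-slack c (sum large) ℓ≤p large-bound) ⟩
  tri c + (c * ℓ + tri ℓ + p * p)     ≡⟨ +-assoc (tri c) (c * ℓ + tri ℓ) (p * p) ⟨
  tri c + (c * ℓ + tri ℓ) + p * p     ≡⟨ cong (_+ p * p) tri-b ⟨
  tri b + p * p                       ∎
  where
  open ≤-Reasoning
  c = b ∸ p
  small = filter (_<? c) V
  large = filter (∁? (_<? c)) V
  ℓ = length large
  V↭small++large : V ↭ small ++ large
  V↭small++large = ↭-filter-++-reject (_<? c) V
  small↭range : small ↭ range 0 c
  small↭range = ↭-range 0 c (Unique.filter⁺ (_<? c) V!)
    (mk⇔ (λ y∈ → z≤n , proj₂ (∈-filter⁻ (_<? c) {xs = V} y∈)) (λ (_ , y<c) → ∈-filter⁺ (_<? c) (V⊇ y<c) y<c))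
  sum-small : sum small ≡ tri c
  sum-small = trans (sum-↭ small↭range) (sum-range 0 c)
  b≡c+ℓ : b ≡ c + ℓ
  b≡c+ℓ = begin-equality
    b                             ≡⟨ |V|≡b ⟨
    length V                      ≡⟨ ↭-length V↭small++large ⟩
    length (small ++ large)       ≡⟨ length-++ small ⟩
    length small + ℓ              ≡⟨ cong (_+ ℓ) (trans (↭-length small↭range) (length-range 0 c)) ⟩
    c + ℓ                         ∎
  ℓ≤p : ℓ ≤ p
  ℓ≤p = +-cancelˡ-≤ c ℓ p (begin
    c + ℓ ≡⟨ b≡c+ℓ ⟨
    b     ≤⟨ m≤n+m∸n b p ⟩
    p + c ≡⟨ +-comm p c ⟩
    c + p ∎)
  large-bound : sum large + (tri ℓ + ℓ) ≤ ℓ * (c + ℓ + p)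
  large-bound = subst (λ b′ → sum large + (tri ℓ + ℓ) ≤ ℓ * (b′ + p)) b≡c+ℓ
    (sum+tri≤length*bound (Unique.filter⁺ (∁? (_<? c)) V!)
      (All.filter⁺ (∁? (_<? c)) V<b+p))
  tri-b : tri b ≡ tri c + (c * ℓ + tri ℓ)
  tri-b = trans (cong tri b≡c+ℓ) (trans (tri-+ c ℓ) (cong (tri c +_) (sum-range c ℓ)))

m≤n+o⇒n≤m+o⇒∣m-n∣≤o : ∀ {m n o} → m ≤ n + o → n ≤ m + o → ∣ m - n ∣ ≤ o
m≤n+o⇒n≤m+o⇒∣m-n∣≤o {zero}  {n}     _         n≤o       = n≤o
m≤n+o⇒n≤m+o⇒∣m-n∣≤o {suc m} {zero}  m≤o       _         = m≤o
m≤n+o⇒n≤m+o⇒∣m-n∣≤o {suc m} {suc n} (s≤s m≤) (s≤s n≤) = m≤n+o⇒n≤m+o⇒∣m-n∣≤o m≤ n≤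

module _ {p : ℕ} (σ : ℕ ↔ ℕ) (σ≈id : ∀ x → ∣ Inverse.to σ x - x ∣ ≤ p) where
  open Inverse σ using (to; from; strictlyInverseˡ)

  private
    prefixSum : ℕ → ℕ
    prefixSum b = sum (map to (range 0 b))

    to≤x+p : ∀ x → to x ≤ x + p
    to≤x+p x = ≤-trans (m≤n+∣m-n∣ (to x) x) (+-monoʳ-≤ x (σ≈id x))

    x≤to+p : ∀ x → x ≤ to x + p
    x≤to+p x = ≤-trans (m≤n+∣n-m∣ x (to x)) (+-monoʳ-≤ (to x) (σ≈id x))

    prefix! : ∀ b → Unique (map to (range 0 b))
    prefix! b = Unique.map⁺ (Injection.injective (↔⇒↣ σ)) (range-unique 0 b)

    length-prefix : ∀ b → length (map to (range 0 b)) ≡ b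
    length-prefix b = trans (length-map to (range 0 b)) (length-range 0 b)

    tri≤prefixSum : ∀ b → tri b ≤ prefixSum b
    tri≤prefixSum b = subst (λ ℓ → tri ℓ ≤ prefixSum b) (length-prefix b) (tri-length≤sum (prefix! b))

    prefixSum≤tri+square : ∀ b → prefixSum b ≤ tri b + p * p
    prefixSum≤tri+square b = sum≤tri+square (prefix! b) (length-prefix b) (All.map⁺ (All.tabulate to<b+p)) covers
      where
      to<b+p : ∀ {x} → x ∈ range 0 b → to x < b + p
      to<b+p {x} x∈ = ≤-<-trans (to≤x+p x) (+-monoˡ-< p (proj₂ (Equivalence.to (∈-range 0 b) x∈)))
      covers : ∀ {y} → y < b ∸ p → y ∈ map to (range 0 b)
      covers {y} y<b∸p = subst (_∈ map to (range 0 b)) (strictlyInverseˡ y)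
        (∈-map⁺ to (Equivalence.from (∈-range 0 b) (z≤n , from-y<b)))
        where
        p≤b : p ≤ b
        p≤b = <⇒≤ (m∸n≢0⇒n<m (>⇒≢ (≤-<-trans z≤n y<b∸p)))
        from-y<b : from y < b
        from-y<b = ≤-<-trans (subst (λ z → from y ≤ z + p) (strictlyInverseˡ y) (x≤to+p (from y)))
                             (m≤o∸n⇒m+n≤o (suc y) p≤b y<b∸p)

  ∣sum-map-range-sum-range∣≤square : ∀ a k → ∣ sum (map to (range a k)) - sum (range a k) ∣ ≤ p * p
  ∣sum-map-range-sum-range∣≤square a k = m≤n+o⇒n≤m+o⇒∣m-n∣≤o upper lower
    where
    X = sum (map to (range a k))
    Y = sum (range a k)
    prefixSum-+ : prefixSum (a + k) ≡ prefixSum a + X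
    prefixSum-+ = begin
      sum (map to (range 0 (a + k)))                  ≡⟨ cong (λ xs → sum (map to xs)) (range-++ 0 a k) ⟩
      sum (map to (range 0 a ++ range a k))           ≡⟨ cong sum (map-++ to (range 0 a) (range a k)) ⟩
      sum (map to (range 0 a) ++ map to (range a k))  ≡⟨ sum-++ (map to (range 0 a)) (map to (range a k)) ⟩
      prefixSum a + X                                 ∎
      where open ≡-Reasoning
    upper : X ≤ Y + p * p
    upper = +-cancelˡ-≤ (prefixSum a) X (Y + p * p) (begin
      prefixSum a + X            ≡⟨ prefixSum-+ ⟨
      prefixSum (a + k)          ≤⟨ prefixSum≤tri+square (a + k) ⟩
      tri (a + k) + p * p        ≡⟨ cong (_+ p * p) (tri-+ a k) ⟩
      tri a + Y + p * p          ≤⟨ +-monoˡ-≤ (p * p) (+-monoˡ-≤ Y (tri≤prefixSum a)) ⟩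
      prefixSum a + Y + p * p    ≡⟨ +-assoc (prefixSum a) Y (p * p) ⟩
      prefixSum a + (Y + p * p)  ∎)
      where open ≤-Reasoning
    lower : Y ≤ X + p * p
    lower = +-cancelˡ-≤ (tri a) Y (X + p * p) (begin
      tri a + Y                  ≡⟨ tri-+ a k ⟨
      tri (a + k)                ≤⟨ tri≤prefixSum (a + k) ⟩
      prefixSum (a + k)          ≡⟨ prefixSum-+ ⟩
      prefixSum a + X            ≤⟨ +-monoˡ-≤ X (prefixSum≤tri+square a) ⟩
      tri a + p * p + X          ≡⟨ +-assoc (tri a) (p * p) X ⟩
      tri a + (p * p + X)        ≡⟨ cong (tri a +_) (+-comm (p * p) X) ⟩
      tri a + (X + p * p)        ∎)
      where open ≤-Reasoning

data InFin (N : ℕ) : ℕ → Set where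
  fin    : (i : Fin N) → InFin N (toℕ i)
  beyond : ∀ {x} → N ≤ x → InFin N x

inFin : ∀ N x → InFin N x
inFin N x with x <? N
... | yes x<N = subst (InFin N) (toℕ-fromℕ< x<N) (fin (fromℕ< x<N))
... | no x≮N  = beyond (≮⇒≥ x≮N)

extendFin : ∀ {N} → (Fin N → Fin N) → ℕ → ℕ
extendFin {N} f x with x <? N
... | yes x<N = toℕ (f (fromℕ< x<N))
... | no _    = x

module _ {N : ℕ} (f : Fin N → Fin N) where

  extendFin-toℕ : ∀ i → extendFin f (toℕ i) ≡ toℕ (f i)
  extendFin-toℕ i with toℕ i <? N
  ... | yes i<N = cong (toℕ ∘ f) (fromℕ<-toℕ i i<N)
  ... | no i≮N  = contradiction (toℕ<n i) i≮N

  extendFin-≥ : ∀ {x} → N ≤ x → extendFin f x ≡ x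
  extendFin-≥ {x} N≤x with x <? N
  ... | yes x<N = contradiction x<N (≤⇒≯ N≤x)
  ... | no _    = refl

extendFin-inverseˡ : ∀ {N} {f g : Fin N → Fin N} → StrictlyInverseˡ _≡_ f g →
                     StrictlyInverseˡ _≡_ (extendFin f) (extendFin g)
extendFin-inverseˡ {N} {f} {g} f∘g≗id x with inFin N x
... | fin i      = begin
  extendFin f (extendFin g (toℕ i))  ≡⟨ cong (extendFin f) (extendFin-toℕ g i) ⟩
  extendFin f (toℕ (g i))            ≡⟨ extendFin-toℕ f (g i) ⟩
  toℕ (f (g i))                      ≡⟨ cong toℕ (f∘g≗id i) ⟩
  toℕ i                              ∎
  where open ≡-Reasoning
... | beyond N≤x = trans (cong (extendFin f) (extendFin-≥ g N≤x)) (extendFin-≥ f N≤x)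

extend : ∀ {N} → Permutation′ N → ℕ ↔ ℕ
extend π = mk↔ₛ′ (extendFin (π ⟨$⟩ʳ_)) (extendFin (π ⟨$⟩ˡ_))
  (extendFin-inverseˡ (Inverse.strictlyInverseˡ π)) (extendFin-inverseˡ (Inverse.strictlyInverseʳ π))

extend-displacement : ∀ {N p} (π : Permutation′ N) → (∀ i → ∣ toℕ (π ⟨$⟩ʳ i) - toℕ i ∣ ≤ p) →
                      ∀ x → ∣ Inverse.to (extend π) x - x ∣ ≤ p
extend-displacement {N} {p} π π≈id x with inFin N x
... | fin i      = subst (λ y → ∣ y - toℕ i ∣ ≤ p) (sym (extendFin-toℕ (π ⟨$⟩ʳ_) i)) (π≈id i)
... | beyond N≤x = begin
  ∣ extendFin (π ⟨$⟩ʳ_) x - x ∣  ≡⟨ cong ∣_- x ∣ (extendFin-≥ (π ⟨$⟩ʳ_) N≤x) ⟩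
  ∣ x - x ∣                      ≡⟨ ∣n-n∣≡0 x ⟩
  0                              ≤⟨ z≤n ⟩
  p                              ∎
  where open ≤-Reasoning

module _ {n : ℕ} (t θt : Labeling n) where
  private
    t↔ = ⤖⇒↔ t

  -- A label is suc (toℕ i), so the relabelling is lifted to fix 0.
  relabel : Permutation′ (suc (ε n))
  relabel = lift₀ (⤖⇒↔ θt ↔-∘ ↔-sym t↔)

  extend-relabel-label : ∀ e → Inverse.to (extend relabel) (label t e) ≡ label θt e
  extend-relabel-label e = begin
    extendFin (relabel ⟨$⟩ʳ_) (toℕ (Fin.suc i))  ≡⟨ extendFin-toℕ (relabel ⟨$⟩ʳ_) (Fin.suc i) ⟩
    label θt (Inverse.from t↔ i)                  ≡⟨ cong (label θt) (Inverse.strictlyInverseʳ t↔ e) ⟩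
    label θt e                                    ∎
    where
    open ≡-Reasoning
    i = Bijection.to t e

  relabel-displacement : ∀ {p} → IsPSwap p t θt → ∀ i → ∣ toℕ (relabel ⟨$⟩ʳ i) - toℕ i ∣ ≤ p
  relabel-displacement sw Fin.zero    = z≤n
  relabel-displacement {p} sw (Fin.suc i) = subst (_≤ p) (begin
    ∣ label t e - label θt e ∣          ≡⟨ ∣-∣-comm (label t e) (label θt e) ⟩
    ∣ label θt e - label t e ∣          ≡⟨ cong (λ j → ∣ label θt e - suc (toℕ j) ∣) (Inverse.strictlyInverseˡ t↔ i) ⟩
    ∣ label θt e - suc (toℕ i) ∣        ∎) (sw e)
    where
    open ≡-Reasoning
    e = Inverse.from t↔ i

label-injective : ∀ {n} (t : Labeling n) {e e′} → label t e ≡ label t e′ → e ≡ e′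
label-injective t eq = Bijection.injective t (toℕ-injective (suc-injective eq))

lemma5p5 : (n : ℕ) (t : Labeling n) (p : ℕ) → 1 ≤ p →
    (F : List (Edge n)) → Unique F → 2 * p ≤ length F →
    Is1AP (S t F) →
    (θt : Labeling n) → IsPSwap p t θt →
    ∣ s θt F - s t F ∣ ≤ p * p
lemma5p5 _ t p _ F F! _ (a , k , S≈range) θt sw = begin
  ∣ s θt F - s t F ∣                              ≡⟨ cong₂ ∣_-_∣ sθt st ⟩
  ∣ sum (map σ (range a k)) - sum (range a k) ∣   ≤⟨ ∣sum-map-range-sum-range∣≤square (extend (relabel t θt)) σ≈id a k ⟩
  p * p                                           ∎
  where
  open ≤-Reasoning
  σ = Inverse.to (extend (relabel t θt))
  σ≈id = extend-displacement (relabel t θt) (relabel-displacement t θt sw)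
  labels↭range = ↭-range a k (Unique.map⁺ (label-injective t) F!) (λ {m} → S≈range m)
  st : s t F ≡ sum (range a k)
  st = sum-↭ labels↭range
  sθt : s θt F ≡ sum (map σ (range a k))
  sθt = begin-equality
    sum (map (label θt) F)          ≡⟨ cong sum (map-cong (λ e → sym (extend-relabel-label t θt e)) F) ⟩
    sum (map (σ ∘ label t) F)       ≡⟨ cong sum (map-∘ F) ⟩
    sum (map σ (S t F))             ≡⟨ sum-↭ (↭.map⁺ σ labels↭range) ⟩
    sum (map σ (range a k))         ∎
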